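{- Let $G$ be a graph with girth at least $7$. Then $\mu_{\rm d}(G)=0$ if and only if $\delta(G)\ge 2$.
   Context: All graphs are finite, simple, undirected and connected; $\delta(G)$ is the minimum degree, and the girth of an acyclic graph is infinite. For $X\subseteq V(G)$, vertices $u,v\in V(G)$ are $X$-visible if there exists a shortest $u,v$-path $P$ with $V(P)\cap X\subseteq\{u,v\}$. A set $X\subseteq V(G)$ is a dual mutual-visibility set if every two vertices of $X$ are $X$-visible and every two vertices of $V(G)\setminus X$ are $X$-visible. $\mu_{\rm d}(G)$ is the maximum cardinality of a dual mutual-visibility set of $G$ (the empty set is allowed, so the value may be $0$). -}

module Defs where

open import Data.Nat using (ℕ; zero; suc; _≤_)
open import Data.Bool using (Bool; true; false)
open import Data.Fin using (Fin; zero; suc; fromℕ; inject₁)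
open import Data.Fin.Subset using (Subset; _∈_; _∉_; ∣_∣)
open import Data.List using (length; filterᵇ; allFin)
open import Data.Product using (Σ; _×_; ∃; _,_)
open import Data.Sum using (_⊎_)
open import Relation.Binary.PropositionalEquality using (_≡_)
open import Function.Definitions using (Injective)

record Graph : Set where
  field
    n     : ℕ
    adj   : Fin n → Fin n → Bool
    sym   : ∀ u v → adj u v ≡ adj v u
    irrfl : ∀ v → adj v v ≡ false

open Graph public

V : Graph → Set
V G = Fin (n G)

record Walk (G : Graph) (u v : V G) : Set where
  field
    len   : ℕ
    vs    : Fin (suc len) → V G
    start : vs zero ≡ u
    end   : vs (fromℕ len) ≡ v
    step  : ∀ (i : Fin len) → adj G (vs (inject₁ i)) (vs (suc i)) ≡ true

open Walk public

Connected : Graph → Set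
Connected G = ∀ (u v : V G) → Walk G u v

-- A shortest u,v-path: a u,v-walk of minimum length (necessarily a path).
IsShortest : (G : Graph) {u v : V G} → Walk G u v → Set
IsShortest G {u} {v} P = ∀ (W : Walk G u v) → len P ≤ len W

OnWalk : (G : Graph) {u v : V G} → V G → Walk G u v → Set
OnWalk G w P = ∃ λ i → vs P i ≡ w

IsCycle : (G : Graph) {u : V G} → Walk G u u → Set
IsCycle G C = (3 ≤ len C) × Injective _≡_ _≡_ (λ i → vs C (inject₁ i))

GirthAtLeast : Graph → ℕ → Set
GirthAtLeast G g = ∀ (u : V G) (C : Walk G u u) → IsCycle G C → g ≤ len C

deg : (G : Graph) → V G → ℕ
deg G v = length (filterᵇ (adj G v) (allFin (n G)))

MinDegAtLeast : Graph → ℕ → Set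
MinDegAtLeast G k = ∀ (v : V G) → k ≤ deg G v

Visible : (G : Graph) → Subset (n G) → V G → V G → Set
Visible G X u v = Σ (Walk G u v) λ P → IsShortest G P ×
  (∀ w → OnWalk G w P → w ∈ X → (w ≡ u) ⊎ (w ≡ v))

IsDualMV : (G : Graph) → Subset (n G) → Set
IsDualMV G X =
  (∀ u v → u ∈ X → v ∈ X → Visible G X u v) ×
  (∀ u v → u ∉ X → v ∉ X → Visible G X u v)

MuDIs : Graph → ℕ → Set
MuDIs G k = (Σ (Subset (n G)) λ X → IsDualMV G X × ∣ X ∣ ≡ k)
          × (∀ X → IsDualMV G X → ∣ X ∣ ≤ k)

{-# OPTIONS --safe #-}
-- If a vertex v has degree at most 1, it is never interior to a shortest path, so {v} is a
-- dual mutual-visibility set and μ_d(G) > 0. Conversely, let δ(G) ≥ 2 and x ∈ X for a dual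
-- mutual-visibility set X. Girth ≥ 5 makes a–x–b the only shortest path between two neighbours
-- a ≠ b of x, so they cannot lie on the same side of X: x has a neighbour y ∈ X and a neighbour
-- b ∉ X. Applied at y this gives a neighbour c ∉ X of y with c ≠ x, and girth ≥ 7 makes
-- b–x–y–c the only shortest b,c-path; it passes through y ∈ X, a contradiction.
module Submission where

open import Defs hiding (sym)
open import Data.Bool using (true)
open import Data.Bool.Properties using (T-≡) renaming (_≟_ to _≟ᵇ_)
open import Data.Empty using (⊥-elim)
open import Data.Fin using (Fin; zero; suc; fromℕ; inject₁; _≟_)
open import Data.Fin.Properties using (any?)
open import Data.Fin.Subset using (Subset; _∈_; _∉_; ∣_∣; ⁅_⁆) renaming (⊥ to ∅)
open import Data.Fin.Subset.Properties using (_∈?_; ∉⊥; ∣⊥∣≡0; x∈⁅x⁆; x∈⁅y⁆⇒x≡y; ∣⁅x⁆∣≡1; Empty-unique)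
open import Data.List as List using (List; []; _∷_; filterᵇ; allFin; tabulate)
open import Data.List.Membership.Propositional using () renaming (_∈_ to _∈ₗ_)
open import Data.List.Membership.Propositional.Properties using (∈-filter⁺; ∈-filter⁻; ∈-allFin)
open import Data.List.Relation.Unary.Any using (here; there)
open import Data.List.Relation.Unary.All using ([]; _∷_)
open import Data.List.Relation.Unary.All.Properties using (tabulate⁻)
open import Data.List.Relation.Unary.AllPairs using ([]; _∷_)
open import Data.List.Relation.Unary.Unique.Propositional using (Unique)
open import Data.List.Relation.Unary.Unique.Propositional.Properties using (allFin⁺; filter⁺)
open import Data.Nat using (ℕ; zero; suc; _+_; _≤_; z≤n; s≤s; _≤?_)
open import Data.Nat.Properties using (≤-refl; ≤-trans; ≤-pred; ≤-reflexive; <⇒≱; ≮⇒≥; n≤1+n)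
open import Data.Product using (∃; ∃₂; _×_; _,_; proj₂)
open import Data.Sum using (_⊎_; inj₁; inj₂; [_,_]′)
open import Function using (_∘_)
open import Function.Bundles using (_⇔_; mk⇔; Equivalence)
open import Function.Definitions using (Injective)
open import Relation.Binary.PropositionalEquality
  using (_≡_; _≢_; refl; sym; trans; cong; subst; subst₂; ≢-sym)
open import Relation.Nullary using (¬_; Dec; yes; no; contradiction)
open import Relation.Nullary.Decidable using (map′; _×-dec_; T?; from-yes; from-no)

module _ {A : Set} where

  two-distinct⇒2≤length : ∀ {a b : A} {xs} → a ∈ₗ xs → b ∈ₗ xs → a ≢ b → 2 ≤ List.length xs
  two-distinct⇒2≤length (here refl) (here refl) a≢b = contradiction refl a≢b
  two-distinct⇒2≤length (here _)    (there b∈)  _   = s≤s (non-empty b∈)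
    where
    non-empty : ∀ {x : A} {xs} → x ∈ₗ xs → 1 ≤ List.length xs
    non-empty (here _)  = s≤s z≤n
    non-empty (there _) = s≤s z≤n
  two-distinct⇒2≤length (there a∈)  (here _)    a≢b =
    two-distinct⇒2≤length (here refl) (there a∈) (≢-sym a≢b)
  two-distinct⇒2≤length (there a∈)  (there b∈)  a≢b =
    ≤-trans (two-distinct⇒2≤length a∈ b∈ a≢b) (n≤1+n _)

  Unique⇒two-distinct : ∀ {xs : List A} → Unique xs → 2 ≤ List.length xs →
                        ∃₂ λ a b → a ∈ₗ xs × b ∈ₗ xs × a ≢ b
  Unique⇒two-distinct {a ∷ b ∷ _} ((a≢b ∷ _) ∷ _) _ = a , b , here refl , there (here refl) , a≢b
  Unique⇒two-distinct {_ ∷ []}    _ (s≤s ())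

  tabulate-injective : ∀ {k} {f : Fin k → A} → Unique (tabulate f) → Injective _≡_ _≡_ f
  tabulate-injective _            {zero}  {zero}  _     = refl
  tabulate-injective (f₀∉ ∷ _)    {zero}  {suc j} f₀≡fⱼ = contradiction f₀≡fⱼ (tabulate⁻ f₀∉ j)
  tabulate-injective (f₀∉ ∷ _)    {suc i} {zero}  fᵢ≡f₀ = contradiction (sym fᵢ≡f₀) (tabulate⁻ f₀∉ i)
  tabulate-injective (_ ∷ unique) {suc i} {suc j} fᵢ≡fⱼ = cong suc (tabulate-injective unique fᵢ≡fⱼ)

module _ (G : Graph) where

  Adj : V G → V G → Set
  Adj u v = adj G u v ≡ true

  private variable
    g : ℕ
    u v w x y a b z : V G
    v₀ v₁ v₂ v₃ v₄ v₅ : V G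

  adj⇒≢ : Adj u v → u ≢ v
  adj⇒≢ {u} uv refl = contradiction (trans (sym (irrfl G u)) uv) λ ()

  adj-sym : Adj u v → Adj v u
  adj-sym {u} {v} uv = trans (Defs.sym G v u) uv

  -- Inductive walks, convenient for case analysis on short walks; toWalk and fromWalk
  -- transfer lengths, vertices and shortestness to and from the Fin-indexed Walk.
  infixr 5 _∷_
  data Route : V G → V G → Set where
    []  : Route u u
    _∷_ : Adj u v → Route v w → Route u w

  length : Route u v → ℕ
  length []      = 0
  length (_ ∷ Q) = suc (length Q)

  vertices : Route u v → List (V G)
  vertices {u} []      = u ∷ []
  vertices {u} (_ ∷ Q) = u ∷ vertices Q

  _∈ᵣ_ : V G → Route u v → Set
  z ∈ᵣ Q = z ∈ₗ vertices Q

  Shortest : Route u v → Set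
  Shortest {u} {v} Q = ∀ (Q′ : Route u v) → length Q ≤ length Q′

  _∷ʷ_ : Adj u v → Walk G v w → Walk G u w
  _∷ʷ_ {u} uv W = record
    { len = suc (len W) ; vs = vs′ ; start = refl ; end = end W ; step = step′ }
    where
    vs′ : Fin (suc (suc (len W))) → V G
    vs′ zero    = u
    vs′ (suc i) = vs W i
    step′ : ∀ i → Adj (vs′ (inject₁ i)) (vs′ (suc i))
    step′ zero    = subst (Adj u) (sym (start W)) uv
    step′ (suc i) = step W i

  toWalk : Route u v → Walk G u v
  toWalk {u} []  = record { len = 0 ; vs = λ _ → u ; start = refl ; end = refl ; step = λ () }
  toWalk (uv ∷ Q) = uv ∷ʷ toWalk Q

  len-toWalk : (Q : Route u v) → len (toWalk Q) ≡ length Q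
  len-toWalk []      = refl
  len-toWalk (_ ∷ Q) = cong suc (len-toWalk Q)

  ∈-toWalk : (Q : Route u v) → OnWalk G z (toWalk Q) → z ∈ᵣ Q
  ∈-toWalk []      (_ , refl)     = here refl
  ∈-toWalk (_ ∷ Q) (zero  , refl) = here refl
  ∈-toWalk (_ ∷ Q) (suc i , vsᵢ≡z) = there (∈-toWalk Q (i , vsᵢ≡z))

  fromVertices : ∀ l (f : Fin (suc l) → V G) → (∀ i → Adj (f (inject₁ i)) (f (suc i))) →
                 Route (f zero) (f (fromℕ l))
  fromVertices zero    f steps = []
  fromVertices (suc l) f steps = steps zero ∷ fromVertices l (f ∘ suc) (steps ∘ suc)

  length-fromVertices : ∀ l f steps → length (fromVertices l f steps) ≡ l
  length-fromVertices zero    f steps = refl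
  length-fromVertices (suc l) f steps = cong suc (length-fromVertices l (f ∘ suc) (steps ∘ suc))

  ∈-fromVertices : ∀ l f steps → z ∈ᵣ fromVertices l f steps → ∃ λ i → f i ≡ z
  ∈-fromVertices zero    f steps (here z≡f₀)         = zero , sym z≡f₀
  ∈-fromVertices (suc l) f steps (here z≡f₀)         = zero , sym z≡f₀
  ∈-fromVertices (suc l) f steps (there z∈)
    with i , fᵢ≡z ← ∈-fromVertices l (f ∘ suc) (steps ∘ suc) z∈ = suc i , fᵢ≡z

  length-subst₂ : (p : u ≡ x) (q : v ≡ y) (Q : Route u v) → length (subst₂ Route p q Q) ≡ length Q
  length-subst₂ refl refl Q = refl

  ∈-subst₂ : (p : u ≡ x) (q : v ≡ y) (Q : Route u v) → z ∈ᵣ subst₂ Route p q Q → z ∈ᵣ Q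
  ∈-subst₂ refl refl Q z∈ = z∈

  fromWalk : Walk G u v → Route u v
  fromWalk W = subst₂ Route (start W) (end W) (fromVertices (len W) (vs W) (step W))

  length-fromWalk : (W : Walk G u v) → length (fromWalk W) ≡ len W
  length-fromWalk W =
    trans (length-subst₂ (start W) (end W) _) (length-fromVertices (len W) (vs W) (step W))

  ∈-fromWalk : (W : Walk G u v) → z ∈ᵣ fromWalk W → OnWalk G z W
  ∈-fromWalk W z∈ = ∈-fromVertices (len W) (vs W) (step W) (∈-subst₂ (start W) (end W) _ z∈)

  toWalk-shortest : (Q : Route u v) → Shortest Q → IsShortest G (toWalk Q)
  toWalk-shortest Q shortest W =
    subst₂ _≤_ (sym (len-toWalk Q)) (length-fromWalk W) (shortest (fromWalk W))

  fromWalk-shortest : (W : Walk G u v) → IsShortest G W → Shortest (fromWalk W)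
  fromWalk-shortest W shortest Q =
    subst₂ _≤_ (sym (length-fromWalk W)) (len-toWalk Q) (shortest (toWalk Q))

  route≤? : ∀ k u v → Dec (∃ λ (Q : Route u v) → length Q ≤ k)
  route≤? k u v with u ≟ v
  ... | yes refl = yes ([] , z≤n)
  route≤? zero    u v | no u≢v = no λ { ([] , _) → u≢v refl }
  route≤? (suc k) u v | no u≢v =
    map′ viaNeighbour fromNeighbour (any? λ w → (adj G u w ≟ᵇ true) ×-dec route≤? k w v)
    where
    viaNeighbour : (∃ λ w → Adj u w × ∃ λ (Q : Route w v) → length Q ≤ k) →
                   ∃ λ (Q : Route u v) → length Q ≤ suc k
    viaNeighbour (_ , uw , Q , Q≤k) = uw ∷ Q , s≤s Q≤k
    fromNeighbour : (∃ λ (Q : Route u v) → length Q ≤ suc k) →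
                    ∃ λ w → Adj u w × ∃ λ (Q : Route w v) → length Q ≤ k
    fromNeighbour ([]     , _)       = contradiction refl u≢v
    fromNeighbour (uw ∷ Q , s≤s Q≤k) = _ , uw , Q , Q≤k

  shortest-below : ∀ k (Q : Route u v) → length Q ≤ k → ∃ (Shortest {u} {v})
  shortest-below zero Q Q≤0 = Q , λ _ → ≤-trans Q≤0 z≤n
  shortest-below {u} {v} (suc k) Q Q≤1+k with route≤? k u v
  ... | yes (Q′ , Q′≤k) = shortest-below k Q′ Q′≤k
  ... | no ∄Q′≤k = Q , λ Q′ → ≮⇒≥ λ Q′<Q → ∄Q′≤k (Q′ , ≤-pred (≤-trans Q′<Q Q≤1+k))

  shortest-route : Connected G → ∀ u v → ∃ (Shortest {u} {v})
  shortest-route connected u v = shortest-below _ (fromWalk (connected u v)) ≤-refl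

  Avoids : Subset (n G) → Route u v → Set
  Avoids {u} {v} X Q = ∀ w → w ∈ᵣ Q → w ∈ X → w ≡ u ⊎ w ≡ v

  shortest-avoiding⇒visible : ∀ {X} (Q : Route u v) → Shortest Q → Avoids X Q → Visible G X u v
  shortest-avoiding⇒visible Q shortest avoids =
    toWalk Q , toWalk-shortest Q shortest , λ w w∈ → avoids w (∈-toWalk Q w∈)

  visible⇒shortest-avoiding : ∀ {X} → Visible G X u v → ∃ λ (Q : Route u v) → Shortest Q × Avoids X Q
  visible⇒shortest-avoiding (W , shortest , avoids) =
    fromWalk W , fromWalk-shortest W shortest , λ w w∈ → avoids w (∈-fromWalk W w∈)

  neighbours : V G → List (V G)
  neighbours v = filterᵇ (adj G v) (allFin (n G))

  ∈-neighbours⁺ : Adj v a → a ∈ₗ neighbours v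
  ∈-neighbours⁺ {v} {a} va = ∈-filter⁺ (T? ∘ adj G v) (∈-allFin a) (Equivalence.from T-≡ va)

  ∈-neighbours⁻ : a ∈ₗ neighbours v → Adj v a
  ∈-neighbours⁻ {v = v} a∈ = Equivalence.to T-≡ (proj₂ (∈-filter⁻ (T? ∘ adj G v) {xs = allFin (n G)} a∈))

  2≤deg⇒two-neighbours : 2 ≤ deg G v → ∃₂ λ a b → Adj v a × Adj v b × a ≢ b
  2≤deg⇒two-neighbours {v} 2≤deg
    with a , b , a∈ , b∈ , a≢b ← Unique⇒two-distinct (filter⁺ (T? ∘ adj G v) (allFin⁺ (n G))) 2≤deg
    = a , b , ∈-neighbours⁻ a∈ , ∈-neighbours⁻ b∈ , a≢b

  two-neighbours⇒2≤deg : Adj v a → Adj v b → a ≢ b → 2 ≤ deg G v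
  two-neighbours⇒2≤deg va vb = two-distinct⇒2≤length (∈-neighbours⁺ va) (∈-neighbours⁺ vb)

  2≤deg⇒neighbour-≢ : 2 ≤ deg G v → ∀ z → ∃ λ c → Adj v c × c ≢ z
  2≤deg⇒neighbour-≢ 2≤deg z with a , b , va , vb , a≢b ← 2≤deg⇒two-neighbours 2≤deg | a ≟ z
  ... | yes refl = b , vb , ≢-sym a≢b
  ... | no a≢z   = a , va , a≢z

  interior-neighbours : ∀ v (Q : Route u w) → v ∈ᵣ Q → v ≢ u → v ≢ w →
    ∃₂ λ p s → Adj v p × Adj v s × (p ≡ s → ∃ λ (Q′ : Route u w) → 2 + length Q′ ≤ length Q)
  interior-neighbours v []      (here v≡u) v≢u _ = contradiction v≡u v≢u
  interior-neighbours v (_ ∷ _) (here v≡u) v≢u _ = contradiction v≡u v≢u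
  interior-neighbours v (_∷_ {v = u′} _ _) (there _) _ _ with v ≟ u′
  interior-neighbours v (_ ∷ [])            _ _ v≢w | yes refl = contradiction refl v≢w
  interior-neighbours {u} v (uv ∷ vs ∷ Q)   _ _ _   | yes refl =
    u , _ , adj-sym uv , vs , λ { refl → Q , ≤-refl }
  interior-neighbours v (uu′ ∷ Q) (there v∈Q) _ v≢w | no v≢u′
    with p , s , vp , vs , shortcut ← interior-neighbours v Q v∈Q v≢u′ v≢w =
    p , s , vp , vs , λ p≡s → let Q′ , Q′+2≤Q = shortcut p≡s in uu′ ∷ Q′ , s≤s Q′+2≤Q

  shortest-interior⇒2≤deg : {Q : Route u w} → Shortest Q → v ∈ᵣ Q → v ≢ u → v ≢ w → 2 ≤ deg G v
  shortest-interior⇒2≤deg {v = v} {Q = Q} shortest v∈Q v≢u v≢w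
    with p , s , vp , vs , shortcut ← interior-neighbours v Q v∈Q v≢u v≢w | p ≟ s
  ... | no p≢s = two-neighbours⇒2≤deg vp vs p≢s
  ... | yes p≡s with Q′ , Q′+2≤Q ← shortcut p≡s =
    ⊥-elim (<⇒≱ (≤-trans (n≤1+n _) Q′+2≤Q) (shortest Q′))

  front : Route u v → List (V G)
  front []          = []
  front {u} (_ ∷ Q) = u ∷ front Q

  front≡tabulate : (Q : Route u v) → front Q ≡ tabulate (vs (toWalk Q) ∘ inject₁)
  front≡tabulate []      = refl
  front≡tabulate (_ ∷ Q) = cong (_ ∷_) (front≡tabulate Q)

  girth≤cycle : GirthAtLeast G g → (C : Route u u) → 3 ≤ length C → Unique (front C) → g ≤ length C
  girth≤cycle {g} {u} girth C 3≤C unique = subst (g ≤_) (len-toWalk C) (girth u (toWalk C) cycle)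
    where
    cycle : IsCycle G (toWalk C)
    cycle = subst (3 ≤_) (sym (len-toWalk C)) 3≤C
          , tabulate-injective (subst Unique (front≡tabulate C) unique)

  girth-weaken : ∀ {h} → g ≤ h → GirthAtLeast G h → GirthAtLeast G g
  girth-weaken g≤h girth u C cycle = ≤-trans g≤h (girth u C cycle)

  triangle : GirthAtLeast G g → Adj v₀ v₁ → Adj v₁ v₂ → Adj v₂ v₀ → g ≤ 3
  triangle girth e₀ e₁ e₂ = girth≤cycle girth (e₀ ∷ e₁ ∷ e₂ ∷ []) (s≤s (s≤s (s≤s z≤n)))
    ( (adj⇒≢ e₀ ∷ ≢-sym (adj⇒≢ e₂) ∷ [])
    ∷ (adj⇒≢ e₁ ∷ [])
    ∷ [] ∷ [])

  square : GirthAtLeast G g → Adj v₀ v₁ → Adj v₁ v₂ → Adj v₂ v₃ → Adj v₃ v₀ →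
           v₀ ≢ v₂ → v₁ ≢ v₃ → g ≤ 4
  square girth e₀ e₁ e₂ e₃ v₀≢v₂ v₁≢v₃ = girth≤cycle girth (e₀ ∷ e₁ ∷ e₂ ∷ e₃ ∷ []) (s≤s (s≤s (s≤s z≤n)))
    ( (adj⇒≢ e₀ ∷ v₀≢v₂ ∷ ≢-sym (adj⇒≢ e₃) ∷ [])
    ∷ (adj⇒≢ e₁ ∷ v₁≢v₃ ∷ [])
    ∷ (adj⇒≢ e₂ ∷ [])
    ∷ [] ∷ [])

  pentagon : GirthAtLeast G g → Adj v₀ v₁ → Adj v₁ v₂ → Adj v₂ v₃ → Adj v₃ v₄ → Adj v₄ v₀ →
             v₀ ≢ v₂ → v₀ ≢ v₃ → v₁ ≢ v₃ → v₁ ≢ v₄ → v₂ ≢ v₄ → g ≤ 5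
  pentagon girth e₀ e₁ e₂ e₃ e₄ v₀≢v₂ v₀≢v₃ v₁≢v₃ v₁≢v₄ v₂≢v₄ =
    girth≤cycle girth (e₀ ∷ e₁ ∷ e₂ ∷ e₃ ∷ e₄ ∷ []) (s≤s (s≤s (s≤s z≤n)))
    ( (adj⇒≢ e₀ ∷ v₀≢v₂ ∷ v₀≢v₃ ∷ ≢-sym (adj⇒≢ e₄) ∷ [])
    ∷ (adj⇒≢ e₁ ∷ v₁≢v₃ ∷ v₁≢v₄ ∷ [])
    ∷ (adj⇒≢ e₂ ∷ v₂≢v₄ ∷ [])
    ∷ (adj⇒≢ e₃ ∷ [])
    ∷ [] ∷ [])

  hexagon : GirthAtLeast G g → Adj v₀ v₁ → Adj v₁ v₂ → Adj v₂ v₃ → Adj v₃ v₄ → Adj v₄ v₅ → Adj v₅ v₀ →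
            v₀ ≢ v₂ → v₀ ≢ v₃ → v₀ ≢ v₄ → v₁ ≢ v₃ → v₁ ≢ v₄ → v₁ ≢ v₅ → v₂ ≢ v₄ → v₂ ≢ v₅ → v₃ ≢ v₅ →
            g ≤ 6
  hexagon girth e₀ e₁ e₂ e₃ e₄ e₅ v₀≢v₂ v₀≢v₃ v₀≢v₄ v₁≢v₃ v₁≢v₄ v₁≢v₅ v₂≢v₄ v₂≢v₅ v₃≢v₅ =
    girth≤cycle girth (e₀ ∷ e₁ ∷ e₂ ∷ e₃ ∷ e₄ ∷ e₅ ∷ []) (s≤s (s≤s (s≤s z≤n)))
    ( (adj⇒≢ e₀ ∷ v₀≢v₂ ∷ v₀≢v₃ ∷ v₀≢v₄ ∷ ≢-sym (adj⇒≢ e₅) ∷ [])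
    ∷ (adj⇒≢ e₁ ∷ v₁≢v₃ ∷ v₁≢v₄ ∷ v₁≢v₅ ∷ [])
    ∷ (adj⇒≢ e₂ ∷ v₂≢v₄ ∷ v₂≢v₅ ∷ [])
    ∷ (adj⇒≢ e₃ ∷ v₃≢v₅ ∷ [])
    ∷ (adj⇒≢ e₄ ∷ [])
    ∷ [] ∷ [])

  walk₃-ends-≢ : GirthAtLeast G 4 → Adj v₀ v₁ → Adj v₁ v₂ → Adj v₂ v₃ → v₀ ≢ v₃
  walk₃-ends-≢ girth e₀ e₁ e₂ refl = contradiction (triangle girth e₀ e₁ e₂) (from-no (4 ≤? 3))

  path₃-ends-nonadjacent : GirthAtLeast G 5 → Adj v₀ v₁ → Adj v₁ v₂ → Adj v₂ v₃ →
                           v₀ ≢ v₂ → v₁ ≢ v₃ → ¬ Adj v₀ v₃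
  path₃-ends-nonadjacent girth e₀ e₁ e₂ v₀≢v₂ v₁≢v₃ e₃ =
    contradiction (square girth e₀ e₁ e₂ (adj-sym e₃) v₀≢v₂ v₁≢v₃) (from-no (5 ≤? 4))

  common-neighbour-on-shortest : GirthAtLeast G 5 → Adj x a → Adj x b → a ≢ b →
                                 (Q : Route a b) → Shortest Q → x ∈ᵣ Q
  common-neighbour-on-shortest girth xa xb a≢b [] _ = contradiction refl a≢b
  common-neighbour-on-shortest girth xa xb a≢b (ab ∷ []) _ =
    contradiction (triangle girth xa ab (adj-sym xb)) (from-no (5 ≤? 3))
  common-neighbour-on-shortest {x} girth xa xb a≢b (_∷_ {v = m} am (mb ∷ [])) _ with m ≟ x
  ... | yes refl = there (here refl)
  ... | no m≢x   = contradiction (square girth xa am mb (adj-sym xb) (≢-sym m≢x) a≢b) (from-no (5 ≤? 4))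
  common-neighbour-on-shortest girth xa xb a≢b (_ ∷ _ ∷ _ ∷ _) shortest =
    ⊥-elim (<⇒≱ (s≤s (s≤s (s≤s z≤n))) (shortest (adj-sym xa ∷ xb ∷ [])))

  module _ (girth : GirthAtLeast G 7) where
    private
      triangle-free : GirthAtLeast G 4
      triangle-free = girth-weaken (from-yes (4 ≤? 7)) girth

      square-free : GirthAtLeast G 5
      square-free = girth-weaken (from-yes (5 ≤? 7)) girth

    -- A shortest a,b-route has length at most 3, so unless it is a–x–y–b itself it closes
    -- a cycle of length at most 6 with that path.
    path₃-middle-on-shortest : Adj a x → Adj x y → Adj y b → a ≢ y → x ≢ b →
                               (Q : Route a b) → Shortest Q → y ∈ᵣ Q
    path₃-middle-on-shortest ax xy yb _ _ [] _ = contradiction refl (walk₃-ends-≢ triangle-free ax xy yb)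
    path₃-middle-on-shortest ax xy yb a≢y x≢b (ab ∷ []) _ =
      contradiction ab (path₃-ends-nonadjacent square-free ax xy yb a≢y x≢b)
    path₃-middle-on-shortest ax xy yb a≢y x≢b (am ∷ mb ∷ []) _ =
      contradiction
        (pentagon girth ax xy yb (adj-sym mb) (adj-sym am)
          a≢y (walk₃-ends-≢ triangle-free ax xy yb) x≢b
          (walk₃-ends-≢ triangle-free xy yb (adj-sym mb))
          (≢-sym (walk₃-ends-≢ triangle-free (adj-sym am) ax xy)))
        (from-no (7 ≤? 5))
    path₃-middle-on-shortest {a} {x} {y} {b} ax xy yb a≢y x≢b
      (_∷_ {v = m₁} am₁ (_∷_ {v = m₂} m₁m₂ (m₂b ∷ []))) _ with m₂ ≟ y | m₁ ≟ x
    ... | yes refl | _        = there (there (here refl))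
    ... | no m₂≢y  | yes refl =
      contradiction (square girth xy yb (adj-sym m₂b) (adj-sym m₁m₂) x≢b (≢-sym m₂≢y)) (from-no (7 ≤? 4))
    ... | no m₂≢y  | no m₁≢x  =
      contradiction
        (hexagon girth ax xy yb (adj-sym m₂b) (adj-sym m₁m₂) (adj-sym am₁)
          a≢y (walk₃-ends-≢ triangle-free ax xy yb) (λ { refl → a≁b m₂b }) x≢b
          (walk₃-ends-≢ triangle-free xy yb (adj-sym m₂b)) (≢-sym m₁≢x)
          (≢-sym m₂≢y) (≢-sym (walk₃-ends-≢ triangle-free (adj-sym am₁) ax xy)) (λ { refl → a≁b am₁ }))
        (from-no (7 ≤? 6))
      where
      a≁b : ¬ Adj a b
      a≁b = path₃-ends-nonadjacent square-free ax xy yb a≢y x≢b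
    path₃-middle-on-shortest ax xy yb _ _ (_ ∷ _ ∷ _ ∷ _ ∷ _) shortest =
      ⊥-elim (<⇒≱ (s≤s (s≤s (s≤s (s≤s z≤n)))) (shortest (ax ∷ xy ∷ yb ∷ [])))

  all-shortest-avoid⇒visible : ∀ {X} → Connected G →
    (∀ (Q : Route u v) → Shortest Q → Avoids X Q) → Visible G X u v
  all-shortest-avoid⇒visible {u} {v} connected avoids
    with Q , shortest ← shortest-route connected u v =
    shortest-avoiding⇒visible Q shortest (avoids Q shortest)

  ∅-isDualMV : Connected G → IsDualMV G ∅
  ∅-isDualMV connected =
    (λ _ _ u∈∅ _ → contradiction u∈∅ ∉⊥) ,
    (λ _ _ _ _ → all-shortest-avoid⇒visible connected λ _ _ _ _ z∈∅ → contradiction z∈∅ ∉⊥)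

  ⁅⁆-isDualMV : Connected G → ¬ 2 ≤ deg G v → IsDualMV G ⁅ v ⁆
  ⁅⁆-isDualMV {v} connected deg<2 = inside , outside
    where
    inside : ∀ u w → u ∈ ⁅ v ⁆ → w ∈ ⁅ v ⁆ → Visible G ⁅ v ⁆ u w
    inside _ _ u∈⁅v⁆ _ = all-shortest-avoid⇒visible connected λ _ _ _ _ z∈⁅v⁆ →
      inj₁ (trans (x∈⁅y⁆⇒x≡y v z∈⁅v⁆) (sym (x∈⁅y⁆⇒x≡y v u∈⁅v⁆)))
    outside : ∀ u w → u ∉ ⁅ v ⁆ → w ∉ ⁅ v ⁆ → Visible G ⁅ v ⁆ u w
    outside u w u∉⁅v⁆ w∉⁅v⁆ = all-shortest-avoid⇒visible connected λ { Q shortest z z∈Q z∈⁅v⁆ →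
      contradiction
        (shortest-interior⇒2≤deg shortest (subst (_∈ᵣ Q) (x∈⁅y⁆⇒x≡y v z∈⁅v⁆) z∈Q)
          (λ { refl → u∉⁅v⁆ (x∈⁅x⁆ v) }) (λ { refl → w∉⁅v⁆ (x∈⁅x⁆ v) }))
        deg<2 }

  SameSide : Subset (n G) → V G → V G → Set
  SameSide X a b = (a ∈ X × b ∈ X) ⊎ (a ∉ X × b ∉ X)

  dualMV-visible : ∀ {X} → IsDualMV G X → SameSide X a b → Visible G X a b
  dualMV-visible {a} {b} (inside , _) (inj₁ (a∈X , b∈X)) = inside a b a∈X b∈X
  dualMV-visible {a} {b} (_ , outside) (inj₂ (a∉X , b∉X)) = outside a b a∉X b∉X

  on-every-shortest⇒∉ : ∀ {X} → IsDualMV G X → SameSide X a b → z ≢ a → z ≢ b →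
                         (∀ (Q : Route a b) → Shortest Q → z ∈ᵣ Q) → z ∉ X
  on-every-shortest⇒∉ {z = z} dualMV side z≢a z≢b on-every z∈X
    with Q , shortest , avoids ← visible⇒shortest-avoiding (dualMV-visible dualMV side) =
    [ z≢a , z≢b ]′ (avoids z (on-every Q shortest) z∈X)

  module _ (girth : GirthAtLeast G 7) (δ≥2 : MinDegAtLeast G 2) {X} (dualMV : IsDualMV G X) where

    neighbours-not-same-side : x ∈ X → Adj x a → Adj x b → a ≢ b → ¬ SameSide X a b
    neighbours-not-same-side x∈X xa xb a≢b side =
      on-every-shortest⇒∉ dualMV side (adj⇒≢ xa) (adj⇒≢ xb)
        (common-neighbour-on-shortest (girth-weaken (from-yes (5 ≤? 7)) girth) xa xb a≢b) x∈X

    edge-in-X⇒no-neighbour-outside : x ∈ X → y ∈ X → Adj x y → Adj x a → ¬ a ∉ X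
    edge-in-X⇒no-neighbour-outside {x} {y} {a} x∈X y∈X xy xa a∉X
      with c , yc , c≢x ← 2≤deg⇒neighbour-≢ (δ≥2 y) x | c ∈? X
    ... | yes c∈X = neighbours-not-same-side y∈X (adj-sym xy) yc (≢-sym c≢x) (inj₁ (x∈X , c∈X))
    ... | no  c∉X = on-every-shortest⇒∉ dualMV (inj₂ (a∉X , c∉X)) (≢-sym a≢y) (adj⇒≢ yc)
                      (path₃-middle-on-shortest girth (adj-sym xa) xy yc a≢y (≢-sym c≢x)) y∈X
      where
      a≢y : a ≢ y
      a≢y a≡y = a∉X (subst (_∈ X) (sym a≡y) y∈X)

    ∉-dualMV : x ∉ X
    ∉-dualMV {x} x∈X with a , b , xa , xb , a≢b ← 2≤deg⇒two-neighbours (δ≥2 x) | a ∈? X | b ∈? X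
    ... | yes a∈X | yes b∈X = neighbours-not-same-side x∈X xa xb a≢b (inj₁ (a∈X , b∈X))
    ... | no  a∉X | no  b∉X = neighbours-not-same-side x∈X xa xb a≢b (inj₂ (a∉X , b∉X))
    ... | yes a∈X | no  b∉X = edge-in-X⇒no-neighbour-outside x∈X a∈X xa xb b∉X
    ... | no  a∉X | yes b∈X = edge-in-X⇒no-neighbour-outside x∈X b∈X xb xa a∉X

proposition2p4 : (G : Graph) → Connected G → GirthAtLeast G 7 →
    MuDIs G 0 ⇔ MinDegAtLeast G 2
proposition2p4 G connected girth = mk⇔ minimum-degree μd≡0
  where
  minimum-degree : MuDIs G 0 → MinDegAtLeast G 2
  minimum-degree (_ , maximum) v with 2 ≤? deg G v
  ... | yes 2≤deg = 2≤deg
  ... | no  deg<2 = contradiction (subst (_≤ 0) (∣⁅x⁆∣≡1 v) ⁅v⁆≤0) λ ()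
    where
    ⁅v⁆≤0 : ∣ ⁅ v ⁆ ∣ ≤ 0
    ⁅v⁆≤0 = maximum ⁅ v ⁆ (⁅⁆-isDualMV G connected deg<2)

  μd≡0 : MinDegAtLeast G 2 → MuDIs G 0
  μd≡0 δ≥2 = (∅ , ∅-isDualMV G connected , ∣⊥∣≡0 (n G)) , λ X dualMV →
    ≤-reflexive (trans (cong ∣_∣ (X≡∅ dualMV)) (∣⊥∣≡0 (n G)))
    where
    X≡∅ : ∀ {X} → IsDualMV G X → X ≡ ∅
    X≡∅ dualMV = Empty-unique λ (_ , x∈X) → ∉-dualMV G girth δ≥2 dualMV x∈X
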